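{- Let $0<\epsilon\leq 1$ be a real number. For every deterministic online coloring algorithm $\mathcal{A}$ having a reordering buffer of size $b$ and every integer $n$ with $b\leq n^{1-\epsilon}$ and $n\geq 2^{7/\epsilon}$, there exists an $n$-vertex tree $G$ such that the number of colors used by $\mathcal{A}$ is $\Omega(\epsilon\cdot\log n)$, with an absolute implicit constant.
   Context: Online graph coloring with a reordering buffer of size $b$: the vertices $v_1,\dots,v_n$ arrive one at a time in an order chosen (adaptively) by an adversary; when $v_t$ arrives, its edges to previously presented vertices are revealed. The algorithm may store vertices temporarily in a buffer and color them later, with the requirement that at the end of step $t$ at least $t-b$ vertices have been colored; each color assignment is irrevocable and must differ from the colors of the already-colored neighbors. The cost is the number of distinct colors used. Logarithms are base 2.
   Formalization: The parameter ε ranges over the rationals with $0<\epsilon\leq 1$ rather than over the reals. -}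

module Defs where

open import Data.Nat using (ℕ; zero; suc; _≤_; _<_; _∸_)
open import Data.Bool using (Bool; true; false)
open import Data.Fin using (Fin; toℕ)
import Data.Fin.Properties as FinP
open import Data.Maybe using (Maybe; just)
open import Data.List using (List; []; _∷_; _∷ʳ_; length; mapMaybe; deduplicate; allFin)
open import Data.List.Relation.Unary.Linked using (Linked)
open import Data.List.Relation.Unary.Unique.Propositional using (Unique)
open import Data.Product using (Σ; _×_)
open import Relation.Nullary using (¬_)
open import Relation.Binary.PropositionalEquality using (_≡_; _≢_)
import Data.Nat.Properties as ℕP

-- A finite simple (undirected, loopless) graph on the vertex set Fin n.
-- In the online setting, vertex i is the (toℕ i + 1)-th vertex presented:
-- vertex i arrives at step toℕ i + 1.
record Graph (n : ℕ) : Set where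
  field
    adj   : Fin n → Fin n → Bool
    sym   : ∀ u v → adj u v ≡ adj v u
    irrfl : ∀ v → adj v v ≡ false
open Graph public

Edge : ∀ {n} → Graph n → Fin n → Fin n → Set
Edge G u v = adj G u v ≡ true

data Walk {n : ℕ} (G : Graph n) : Fin n → Fin n → Set where
  here : ∀ {u} → Walk G u u
  step : ∀ {u w v} → Edge G u w → Walk G w v → Walk G u v

Connected : ∀ {n} → Graph n → Set
Connected G = ∀ u v → Walk G u v

HasCycle : ∀ {n} → Graph n → Set
HasCycle {n} G =
  Σ (Fin n) λ u → Σ (List (Fin n)) λ xs → Σ (Fin n) λ z →
    1 ≤ length xs × Unique (u ∷ xs ∷ʳ z) × Linked (Edge G) (u ∷ xs ∷ʳ z) × Edge G z u

IsTree : ∀ {n} → Graph n → Set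
IsTree G = Connected G × ¬ HasCycle G

-- The two graphs reveal the same information by the end of step t,
-- i.e. they agree on all pairs among the first t presented vertices.
AgreeUpTo : ∀ {n} → ℕ → Graph n → Graph n → Set
AgreeUpTo t G H = ∀ i j → toℕ i < t → toℕ j < t → adj G i j ≡ adj H i j

-- Partial colorings (colors are natural numbers; nothing = not yet colored).
Coloring : ℕ → Set
Coloring n = Fin n → Maybe ℕ

numColored : ∀ {n} → Coloring n → ℕ
numColored {n} c = length (mapMaybe c (allFin n))

numColors : ∀ {n} → Coloring n → ℕ
numColors {n} c = length (deduplicate ℕP._≟_ (mapMaybe c (allFin n)))

-- A deterministic online coloring algorithm with a reordering buffer of
-- size b, for inputs of n vertices.  'col G t' is the partial coloring
-- present at the end of step t when the input (graph with presentation
-- order) is G.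
record OnlineAlgorithm (n b : ℕ) : Set where
  field
    col         : Graph n → ℕ → Coloring n
    online      : ∀ G H t → AgreeUpTo t G H → ∀ v → col G t v ≡ col H t v
    arrived     : ∀ G t v c → col G t v ≡ just c → toℕ v < t
    irrevocable : ∀ G t v c → col G t v ≡ just c → col G (suc t) v ≡ just c
    proper      : ∀ G t u v c → Edge G u v → col G t u ≡ just c → col G t v ≢ just c
    buffer      : ∀ G t → t ≤ n → t ∸ b ≤ numColored (col G t)
open OnlineAlgorithm public

colorsUsed : ∀ {n b} → OnlineAlgorithm n b → Graph n → ℕ
colorsUsed {n} A G = numColors (col A G n)

-- The adversary only ever hangs current roots below a newly presented vertex, so the input is a
-- forest whose links all point to later vertices, and what the algorithm has already seen never
-- changes.  Call a list of roots with pairwise distinct colours a rainbow set.  Given disjoint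
-- rainbow k-sets S₁ and S₂: if some colour of S₂ is missing from S₁, a root of that colour extends
-- S₁; otherwise a new vertex becomes the parent of all of S₁, so whatever colour it receives avoids
-- the colours of S₁, hence those of S₂, and it completes S₂.  New vertices still uncoloured are in
-- the buffer, so 2(m + b) rainbow k-sets yield m rainbow (k+1)-sets within m + b steps.  Starting
-- from cost K ≤ 2^K (2b + 1) empty sets this forces K colours, and hanging the remaining roots
-- below the last vertex makes the input a tree.  For the largest K with cost K < n, the
-- hypotheses b^q ≤ n^(q-p) and 2^(7q) ≤ n^p give n^p ≤ 2^(4qK).

module Submission where

open import Defs hiding (sym)

open import Data.Bool using (false; _∨_; T; T?; if_then_else_)
open import Data.Bool.Properties using (∨-comm; T-≡)
open import Data.Empty using (⊥-elim)
open import Data.Fin using (Fin; toℕ; fromℕ; fromℕ<)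
import Data.Fin.Properties as Fin
open import Data.List using (List; []; _∷_; _∷ʳ_; _++_; length; concat; map; filter; mapMaybe; deduplicate;
                             allFin; replicate)
import Data.List.Properties as List
open import Data.List.Membership.Propositional using (_∈_; _∉_; find)
open import Data.List.Membership.Propositional.Properties
  using (∈-++⁺ˡ; ∈-++⁺ʳ; ∈-++⁻; ∈-deduplicate⁺; ∈-allFin; ∈-filter⁺; ∈-filter⁻; ∈-map⁻; ∈-upTo⁺)
open import Data.List.Relation.Binary.Disjoint.Propositional using (Disjoint)
import Data.List.Relation.Binary.Disjoint.Propositional.Properties as Disjoint
open import Data.List.Relation.Binary.Pointwise as Pointwise using (Pointwise; []; _∷_)
open import Data.List.Relation.Binary.Subset.Propositional using (_⊆_)
import Data.List.Relation.Binary.Subset.Propositional.Properties as Subset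
open import Data.List.Relation.Unary.All as All using (All; []; _∷_; all?)
import Data.List.Relation.Unary.All.Properties as All
open import Data.List.Relation.Unary.AllPairs as AllPairs using (AllPairs; []; _∷_)
import Data.List.Relation.Unary.AllPairs.Properties as AllPairs
open import Data.List.Relation.Unary.Any as Any using (Any; here; there)
open import Data.List.Relation.Unary.Linked as Linked using (Linked; [-]; _∷_)
open import Data.List.Relation.Unary.Unique.Propositional using (Unique)
import Data.List.Relation.Unary.Unique.Propositional.Properties as Unique
open import Data.Maybe using (Maybe; just; nothing; is-just)
open import Data.Maybe.Properties using (just-injective)
open import Data.Nat using (ℕ; zero; suc; pred; _+_; _*_; _^_; _∸_; _≤_; _<_; _≤′_; z≤n; s≤s; z<s; ≤′-refl;
                            ≤′-step; _≟_; _≤?_; _<?_; >-nonZero)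
open import Data.Nat.Properties
open import Data.Nat.Tactic.RingSolver using (solve-∀)
open import Data.List.Membership.DecPropositional _≟_ using (_∈?_)
open import Data.Product using (Σ; ∃-syntax; _×_; _,_; proj₁; proj₂)
open import Data.Sum using (_⊎_; inj₁; inj₂)
open import Function using (_∘_; flip; Equivalence; mk⇔)
open import Relation.Binary.Definitions using (DecidableEquality)
open import Relation.Binary.PropositionalEquality using (_≡_; _≢_; refl; sym; trans; cong; cong₂; subst)
open import Relation.Nullary using (¬_; ¬?; Dec; yes; no; does; contradiction)
open import Relation.Nullary.Decidable using (_×-dec_; _⊎-dec_; dec-true; dec-false; isYes≗does; does-⇔; toWitness)
open import Relation.Unary using (Decidable)

Linked⇒ends : ∀ {A : Set} {R : A → A → Set} {y z} → (∀ {a b c} → R a b → R b c → R a c) →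
             ∀ ys → Linked R (y ∷ ys ∷ʳ z) → R y z
Linked⇒ends tr [] (r ∷ [-]) = r
Linked⇒ends tr (w ∷ ws) (r ∷ l) = tr r (Linked⇒ends tr ws l)

pointwise-source : ∀ {A B : Set} {R : A → B → Set} {xs ys y} → Pointwise R xs ys → y ∈ ys →
                   ∃[ x ] x ∈ xs × R x y
pointwise-source (r ∷ _) (here refl) = _ , here refl , r
pointwise-source (_ ∷ rs) (there y∈ys) with pointwise-source rs y∈ys
... | x , x∈xs , r = x , there x∈xs , r

∈-mapMaybe⁺ : ∀ {A B : Set} {f : A → Maybe B} {x y xs} → x ∈ xs → f x ≡ just y → y ∈ mapMaybe f xs
∈-mapMaybe⁺ {xs = _ ∷ _} (here refl) fx≡y rewrite fx≡y = here refl
∈-mapMaybe⁺ {f = f} {xs = x′ ∷ _} (there x∈xs) fx≡y with f x′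
... | just _ = there (∈-mapMaybe⁺ x∈xs fx≡y)
... | nothing = ∈-mapMaybe⁺ x∈xs fx≡y

T-is-just : ∀ {A : Set} {m : Maybe A} → T (is-just m) → ∃[ x ] m ≡ just x
T-is-just {m = just x} _ = x , refl

¬T-is-just : ∀ {A : Set} {m : Maybe A} → ¬ T (is-just m) → m ≡ nothing
¬T-is-just {m = just _} not-just = ⊥-elim (not-just _)
¬T-is-just {m = nothing} _ = refl

length-filter-split : ∀ {A : Set} {P : A → Set} (P? : Decidable P) xs →
                      length xs ≡ length (filter P? xs) + length (filter (¬? ∘ P?) xs)
length-filter-split P? [] = refl
length-filter-split P? (x ∷ xs) with P? x
... | yes _ = cong suc (length-filter-split P? xs)
... | no _ = trans (cong suc (length-filter-split P? xs)) (sym (+-suc _ _))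

Disjoint-++ˡ : ∀ {A : Set} {xs ys zs : List A} → Disjoint xs zs → Disjoint ys zs → Disjoint (xs ++ ys) zs
Disjoint-++ˡ {xs = xs} xs#zs ys#zs (v∈xs++ys , v∈zs) with ∈-++⁻ xs v∈xs++ys
... | inj₁ v∈xs = xs#zs (v∈xs , v∈zs)
... | inj₂ v∈ys = ys#zs (v∈ys , v∈zs)

<⇒∉ : ∀ {t v} {S : List ℕ} → All (_< t) S → t ≤ v → v ∉ S
<⇒∉ below t≤v v∈S = <⇒≱ (All.lookup below v∈S) t≤v

module _ {A : Set} (_≟ᴬ_ : DecidableEquality A) where

  unique-⊆⇒length-≤ : ∀ {xs ys : List A} → Unique xs → xs ⊆ ys → length xs ≤ length ys
  unique-⊆⇒length-≤ {[]} _ _ = z≤n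
  unique-⊆⇒length-≤ {x ∷ xs} {ys} (x∉xs ∷ unique) x∷xs⊆ys =
    ≤-<-trans (unique-⊆⇒length-≤ unique xs⊆ys-x)
              (List.filter-notAll ≢x? ys (Any.map (λ x≡y y≢x → y≢x (sym x≡y)) (x∷xs⊆ys (here refl))))
    where
    ≢x? : ∀ y → Dec (y ≢ x)
    ≢x? y = ¬? (y ≟ᴬ x)
    xs⊆ys-x : xs ⊆ filter ≢x? ys
    xs⊆ys-x y∈xs = ∈-filter⁺ ≢x? (x∷xs⊆ys (there y∈xs)) λ y≡x → All.lookup x∉xs y∈xs (sym y≡x)

unique-below⇒length-≤ : ∀ {t} {ws : List ℕ} → Unique ws → All (_< t) ws → length ws ≤ t
unique-below⇒length-≤ {t} unique below =
  subst (_ ≤_) (List.length-upTo t) (unique-⊆⇒length-≤ _≟_ unique (∈-upTo⁺ ∘ All.lookup below))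

pairs-pred : ∀ P m → suc P + suc P ≤ suc (suc m) → P + P ≤ m
pairs-pred P m enough = ≤-pred (subst (_≤ suc m) (+-suc P P) (≤-pred enough))

m<n⇒pred[n]<n : ∀ {m n} → m < n → pred n < n
m<n⇒pred[n]<n {n = suc n} _ = ≤-refl

m∸n+o≤m⇒o≤n : ∀ m n o → m ∸ n + o ≤ m → o ≤ n
m∸n+o≤m⇒o≤n m n o le = +-cancelˡ-≤ (m ∸ n) o n (≤-trans le (subst (m ≤_) (+-comm n (m ∸ n)) (m≤n+m∸n m n)))

crossing : ∀ (h : ℕ → ℕ) {n} m → h 0 < n → n ≤ h m → ∃[ K ] h K < n × n ≤ h (suc K)
crossing h zero h0<n n≤h0 = ⊥-elim (<⇒≱ h0<n n≤h0)
crossing h {n} (suc m) h0<n n≤hm+1 with n ≤? h m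
... | yes n≤hm = crossing h m h0<n n≤hm
... | no n≰hm = m , ≰⇒> n≰hm , n≤hm+1

-- Forests given by parent pointers

Parent : Set
Parent = ℕ → ℕ

-- Links only ever point to later vertices, which makes every parent function a forest.
ChildOf : Parent → ℕ → ℕ → Set
ChildOf f i j = i < j × f i ≡ j

childOf? : ∀ f i j → Dec (ChildOf f i j)
childOf? f i j = (i <? j) ×-dec (f i ≟ j)

adjacent? : ∀ f i j → Dec (ChildOf f i j ⊎ ChildOf f j i)
adjacent? f i j = childOf? f i j ⊎-dec childOf? f j i

forest : ∀ n → Parent → Graph n
forest n f = record
  { adj   = λ a b → does (adjacent? f (toℕ a) (toℕ b))
  ; sym   = λ a b → ∨-comm (does (childOf? f (toℕ a) (toℕ b))) (does (childOf? f (toℕ b) (toℕ a)))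
  ; irrfl = λ a → cong₂ _∨_ (no-loop (toℕ a)) (no-loop (toℕ a))
  }
  where
  no-loop : ∀ i → does (childOf? f i i) ≡ false
  no-loop i = dec-false (childOf? f i i) (<-irrefl refl ∘ proj₁)

module _ {n : ℕ} (f : Parent) where

  private
    G = forest n f

  _↑_ : Fin n → Fin n → Set
  a ↑ b = ChildOf f (toℕ a) (toℕ b)

  edge⇒↑ : ∀ {a b} → Edge G a b → a ↑ b ⊎ b ↑ a
  edge⇒↑ {a} {b} e = toWitness (Equivalence.from T-≡ (trans (isYes≗does (adjacent? f (toℕ a) (toℕ b))) e))

  ↑⇒edge : ∀ {a b} → a ↑ b → Edge G a b
  ↑⇒edge {a} {b} a↑b = dec-true (adjacent? f (toℕ a) (toℕ b)) (inj₁ a↑b)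

  ↑-functional : ∀ {a b c} → a ↑ b → a ↑ c → b ≡ c
  ↑-functional (_ , fa≡b) (_ , fa≡c) = Fin.toℕ-injective (trans (sym fa≡b) fa≡c)

  -- A vertex has only one parent, so a path that has stepped down to a child must keep descending.
  descends : ∀ {x y} ys → y ↑ x → Unique (x ∷ y ∷ ys) → Linked (Edge G) (y ∷ ys) →
             Linked (flip _↑_) (x ∷ y ∷ ys)
  descends [] y↑x _ [-] = y↑x ∷ [-]
  descends (z ∷ zs) y↑x ((_ ∷ x≢z ∷ _) ∷ u) (e ∷ l) with edge⇒↑ e
  ... | inj₁ y↑z = ⊥-elim (x≢z (↑-functional y↑x y↑z))
  ... | inj₂ z↑y = y↑x ∷ descends zs z↑y u l

  descent-ends-below : ∀ {x y} ys {z} → y ↑ x → Unique (x ∷ y ∷ ys ∷ʳ z) → Linked (Edge G) (y ∷ ys ∷ʳ z) →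
                       toℕ z < toℕ y
  descent-ends-below ys y↑x u l with descends (ys ∷ʳ _) y↑x u l
  ... | _ ∷ path = Linked⇒ends (λ p q → <-trans q p) ys (Linked.map {S = _≻_} proj₁ path)
    where
    _≻_ : Fin n → Fin n → Set
    a ≻ b = toℕ b < toℕ a

  ends-above-or-hangs : ∀ y ys {z} → Unique (y ∷ ys ∷ʳ z) → Linked (Edge G) (y ∷ ys ∷ʳ z) →
                        toℕ y < toℕ z ⊎ Any (z ↑_) (y ∷ ys)
  ends-above-or-hangs y [] u (e ∷ [-]) with edge⇒↑ e
  ... | inj₁ y↑z = inj₁ (proj₁ y↑z)
  ... | inj₂ z↑y = inj₂ (here z↑y)
  ends-above-or-hangs y (w ∷ ws) u@(_ ∷ u′) (e ∷ l) with ends-above-or-hangs w ws u′ l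
  ... | inj₂ hangs = inj₂ (there hangs)
  ... | inj₁ w<z with edge⇒↑ e
  ...   | inj₁ y↑w = inj₁ (<-trans (proj₁ y↑w) w<z)
  ...   | inj₂ w↑y = ⊥-elim (<-asym w<z (descent-ends-below ws w↑y u l))

  forest-acyclic : ¬ HasCycle G
  forest-acyclic (u , [] , z , () , _)
  forest-acyclic (u , x ∷ xs , z , _ , unique@(u∉ ∷ rest@(x∉ ∷ _)) , u~x ∷ path , z~u)
    with edge⇒↑ z~u | edge⇒↑ u~x
  ... | inj₂ u↑z | inj₁ u↑x = All.lookup x∉ (∈-++⁺ʳ xs (here refl)) (↑-functional u↑x u↑z)
  ... | inj₂ u↑z | inj₂ x↑u =
    <-asym (proj₁ u↑z) (<-trans (descent-ends-below xs x↑u unique path) (proj₁ x↑u))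
  ... | inj₁ z↑u | u~x′ with ends-above-or-hangs x xs rest path
  ...   | inj₂ hangs = All.lookup (proj₁ (All.∷ʳ⁻ u∉)) (Any.map (↑-functional z↑u) hangs) refl
  ...   | inj₁ x<z with u~x′
  ...     | inj₁ u↑x = <-asym (proj₁ z↑u) (<-trans (proj₁ u↑x) x<z)
  ...     | inj₂ x↑u = <-asym x<z (descent-ends-below xs x↑u unique path)

walk-++ : ∀ {n} {G : Graph n} {a b c} → Walk G a b → Walk G b c → Walk G a c
walk-++ here w = w
walk-++ (step e w) w′ = step e (walk-++ w w′)

walk-reverse : ∀ {n} {G : Graph n} {a b} → Walk G a b → Walk G b a
walk-reverse here = here
walk-reverse {G = G} (step e w) = walk-++ (walk-reverse w) (step (trans (Graph.sym G _ _) e) here)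

forest-connected : ∀ {n} f → (∀ v → suc v < n → v < f v × f v < n) → Connected (forest n f)
forest-connected {suc m} f rooted u v =
  walk-++ (climb m u (m≤n+m m (toℕ u))) (walk-reverse (climb m v (m≤n+m m (toℕ v))))
  where
  G = forest (suc m) f
  climb : ∀ d (a : Fin (suc m)) → m ≤ toℕ a + d → Walk G a (fromℕ m)
  climb d a m≤a+d with suc (toℕ a) <? suc m
  ... | no a≮m = subst (Walk G a) (Fin.toℕ-injective (trans a≡m (sym (Fin.toℕ-fromℕ m)))) here
    where
    a≡m : toℕ a ≡ m
    a≡m = ≤-antisym (≤-pred (Fin.toℕ<n a)) (≮⇒≥ (a≮m ∘ s≤s))
  climb zero a m≤a+0 | yes (s≤s a<m) = ⊥-elim (<⇒≱ a<m (subst (m ≤_) (+-identityʳ _) m≤a+0))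
  climb (suc d) a m≤a+d | yes a<m = step (↑⇒edge f a↑b) (climb d b m≤b+d)
    where
    parent-in-range = rooted (toℕ a) a<m
    b = fromℕ< (proj₂ parent-in-range)
    b≡fa : toℕ b ≡ f (toℕ a)
    b≡fa = Fin.toℕ-fromℕ< (proj₂ parent-in-range)
    a↑b : ChildOf f (toℕ a) (toℕ b)
    a↑b = subst (toℕ a <_) (sym b≡fa) (proj₁ parent-in-range) , sym b≡fa
    m≤b+d : m ≤ toℕ b + d
    m≤b+d = ≤-trans m≤a+d (subst (_≤ toℕ b + d) (sym (+-suc (toℕ a) d)) (+-monoˡ-≤ d (proj₁ a↑b)))

forest-isTree : ∀ {n} f → (∀ v → suc v < n → v < f v × f v < n) → IsTree (forest n f)
forest-isTree f rooted = forest-connected f rooted , forest-acyclic f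

-- Inputs that grow by hanging old roots below new vertices

Root : Parent → ℕ → Set
Root f v = f v ≡ v

-- The input may still change after step t, but only by giving new, later parents to roots.
Extends : ℕ → Parent → Parent → Set
Extends t f g = ∀ v → g v ≡ f v ⊎ (Root f v × t ≤ g v)

Extends-refl : ∀ {t f} → Extends t f f
Extends-refl v = inj₁ refl

Extends-anti : ∀ {t t′ f g} → t ≤ t′ → Extends t′ f g → Extends t f g
Extends-anti t≤t′ f⊑g v with f⊑g v
... | inj₁ gv≡fv = inj₁ gv≡fv
... | inj₂ (root , t′≤gv) = inj₂ (root , ≤-trans t≤t′ t′≤gv)

Extends-trans : ∀ {t t′ f g h} → t ≤ t′ → Extends t f g → Extends t′ g h → Extends t f h
Extends-trans t≤t′ f⊑g g⊑h v with f⊑g v | g⊑h v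
... | inj₁ gv≡fv | inj₁ hv≡gv = inj₁ (trans hv≡gv gv≡fv)
... | inj₁ gv≡fv | inj₂ (gv≡v , t′≤hv) = inj₂ (trans (sym gv≡fv) gv≡v , ≤-trans t≤t′ t′≤hv)
... | inj₂ (fv≡v , t≤gv) | inj₁ hv≡gv = inj₂ (fv≡v , subst (_ ≤_) (sym hv≡gv) t≤gv)
... | inj₂ (fv≡v , _) | inj₂ (_ , t′≤hv) = inj₂ (fv≡v , ≤-trans t≤t′ t′≤hv)

Extends⇒agree : ∀ {n t f g} → Extends t f g → AgreeUpTo t (forest n f) (forest n g)
Extends⇒agree {t = t} {f} {g} f⊑g a b a<t b<t =
  cong₂ _∨_ (same-link (toℕ a) (toℕ b) b<t a<t) (same-link (toℕ b) (toℕ a) a<t b<t)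
  where
  same-link : ∀ i j → j < t → i < t → does (childOf? f i j) ≡ does (childOf? g i j)
  same-link i j j<t _ = does-⇔ (mk⇔ to from) (childOf? f i j) (childOf? g i j)
    where
    to : ChildOf f i j → ChildOf g i j
    to (i<j , fi≡j) with f⊑g i
    ... | inj₁ gi≡fi = i<j , trans gi≡fi fi≡j
    ... | inj₂ (fi≡i , _) = ⊥-elim (<-irrefl (trans (sym fi≡i) fi≡j) i<j)
    from : ChildOf g i j → ChildOf f i j
    from (i<j , gi≡j) with f⊑g i
    ... | inj₁ gi≡fi = i<j , trans (sym gi≡fi) gi≡j
    ... | inj₂ (_ , t≤gi) = ⊥-elim (<⇒≱ j<t (subst (t ≤_) gi≡j t≤gi))

ForestUpTo : ℕ → Parent → Set
ForestUpTo t f = ∀ v → f v ≢ v → v < f v × f v < t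

ForestUpTo⇒Root : ∀ {t f v} → ForestUpTo t f → t ≤ v → Root f v
ForestUpTo⇒Root {f = f} {v} up t≤v with f v ≟ v
... | yes fv≡v = fv≡v
... | no fv≢v = ⊥-elim (<-asym (proj₁ (up v fv≢v)) (<-≤-trans (proj₂ (up v fv≢v)) t≤v))

attach : ∀ {P : ℕ → Set} → Decidable P → ℕ → Parent → Parent
attach P? t f v = if does (P? v) then t else f v

module _ {P : ℕ → Set} (P? : Decidable P) (t : ℕ) (f : Parent) where

  attach-hit : ∀ {v} → P v → attach P? t f v ≡ t
  attach-hit {v} Pv with P? v
  ... | yes _ = refl
  ... | no ¬Pv = ⊥-elim (¬Pv Pv)

  attach-miss : ∀ {v} → ¬ P v → attach P? t f v ≡ f v
  attach-miss {v} ¬Pv with P? v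
  ... | yes Pv = ⊥-elim (¬Pv Pv)
  ... | no _ = refl

  attach-extends : (∀ {v} → P v → Root f v) → Extends t f (attach P? t f)
  attach-extends roots v with P? v
  ... | yes Pv = inj₂ (roots Pv , ≤-refl)
  ... | no _ = inj₁ refl

  attach-forest : ForestUpTo t f → (∀ {v} → P v → v < t) → ForestUpTo (suc t) (attach P? t f)
  attach-forest up below v moved with P? v
  ... | yes Pv = below Pv , ≤-refl
  ... | no _ = proj₁ (up v moved) , m<n⇒m<1+n (proj₂ (up v moved))

-- Online colouring

irrevocable-≤ : ∀ {n b} (A : OnlineAlgorithm n b) G v {t t′ c} → t ≤ t′ →
                col A G t v ≡ just c → col A G t′ v ≡ just c
irrevocable-≤ A G v t≤t′ = go (≤⇒≤′ t≤t′)
  where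
  go : ∀ {t t′ c} → t ≤′ t′ → col A G t v ≡ just c → col A G t′ v ≡ just c
  go ≤′-refl coloured = coloured
  go (≤′-step t≤′t′) coloured = irrevocable A G _ v _ (go t≤′t′ coloured)

module _ {n : ℕ} (c : Coloring n) where

  private
    coloured? : ∀ v → Dec (T (is-just (c v)))
    coloured? v = T? (is-just (c v))

  length-mapMaybe : ∀ vs → length (mapMaybe c vs) ≡ length (filter coloured? vs)
  length-mapMaybe [] = refl
  length-mapMaybe (v ∷ vs) with c v
  ... | just _ = cong suc (length-mapMaybe vs)
  ... | nothing = length-mapMaybe vs

  coloured+uncoloured≤ : ∀ {t} {U : List ℕ} → (∀ v {d} → c v ≡ just d → toℕ v < t) →
                         Unique U → All (_< t) U → (∀ v → toℕ v ∈ U → c v ≡ nothing) →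
                         numColored c + length U ≤ t
  coloured+uncoloured≤ {t} {U} arrived unique-U U-below uncoloured =
    subst (_≤ t) total (unique-below⇒length-≤ (Unique.++⁺ unique-C unique-U disjoint) (All.++⁺ C-below U-below))
    where
    C = filter coloured? (allFin n)
    unique-C : Unique (map toℕ C)
    unique-C = Unique.map⁺ Fin.toℕ-injective (Unique.filter⁺ coloured? (Unique.allFin⁺ n))
    C-below : All (_< t) (map toℕ C)
    C-below = All.map⁺ (All.tabulate below)
      where
      below : ∀ {w} → w ∈ C → toℕ w < t
      below {w} w∈C with c w in eq | proj₂ (∈-filter⁻ coloured? {xs = allFin n} w∈C)
      ... | just _ | _ = arrived w eq
    disjoint : Disjoint (map toℕ C) U
    disjoint (v∈C , v∈U) with ∈-map⁻ toℕ v∈C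
    ... | w , w∈C , refl =
      subst (T ∘ is-just) (uncoloured w v∈U) (proj₂ (∈-filter⁻ coloured? {xs = allFin n} w∈C))
    total : length (map toℕ C ++ U) ≡ numColored c + length U
    total = trans (List.length-++ (map toℕ C))
                  (cong (_+ length U) (trans (List.length-map toℕ C) (sym (length-mapMaybe (allFin n)))))

-- The adversary

-- How many empty sets to start from, and how many steps it takes, to force r colours against a buffer of size b.
cost : ℕ → ℕ → ℕ
cost b zero = 1
cost b (suc r) = (cost b r + b) + (cost b r + b)

r<cost : ∀ b r → r < cost b r
r<cost b zero = z<s
r<cost b (suc r) = begin-strict
  suc r                          ≤⟨ r<cost b r ⟩
  cost b r                       <⟨ m<m+n (cost b r) (≤-<-trans z≤n (r<cost b r)) ⟩
  cost b r + cost b r            ≤⟨ +-mono-≤ (m≤m+n (cost b r) b) (m≤m+n (cost b r) b) ⟩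
  cost b (suc r)                 ∎
  where open ≤-Reasoning

cost-bound : ∀ b r → cost b r + 2 * b ≤ 2 ^ r * (2 * b + 1)
cost-bound b zero = ≤-reflexive (trans (+-comm 1 (2 * b)) (sym (*-identityˡ (2 * b + 1))))
cost-bound b (suc r) = begin
  cost b (suc r) + 2 * b         ≡⟨ double (cost b r) b ⟩
  2 * (cost b r + 2 * b)         ≤⟨ *-monoʳ-≤ 2 (cost-bound b r) ⟩
  2 * (2 ^ r * (2 * b + 1))      ≡⟨ sym (*-assoc 2 (2 ^ r) (2 * b + 1)) ⟩
  2 ^ suc r * (2 * b + 1)        ∎
  where
  open ≤-Reasoning
  double : ∀ c b → (c + b) + (c + b) + 2 * b ≡ 2 * (c + 2 * b)
  double = solve-∀

-- Where a vertex of a newly built set comes from: the old sets V, or the steps from t on.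
Origin : List ℕ → ℕ → ℕ → Set
Origin V t v = v ∈ V ⊎ t ≤ v

Origin-mono : ∀ {V W t t′ v} → V ⊆ W → t ≤ t′ → Origin V t′ v → Origin W t v
Origin-mono V⊆W _ (inj₁ v∈V) = inj₁ (V⊆W v∈V)
Origin-mono _ t≤t′ (inj₂ t′≤v) = inj₂ (≤-trans t≤t′ t′≤v)

Origin⇒∉ : ∀ {V W t v} → Origin V t v → Disjoint V W → All (_< t) W → v ∉ W
Origin⇒∉ (inj₁ v∈V) V#W _ v∈W = V#W (v∈V , v∈W)
Origin⇒∉ (inj₂ t≤v) _ W<t = <⇒∉ W<t t≤v

Origin-apart : ∀ {W t vs ws} → All (λ v → v ∉ W × v < t) vs → All (Origin W t) ws → Disjoint vs ws
Origin-apart vs-new ws-old (v∈vs , v∈ws) with All.lookup vs-new v∈vs | All.lookup ws-old v∈ws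
... | v∉W , _ | inj₁ v∈W = v∉W v∈W
... | _ , v<t | inj₂ t≤v = <⇒≱ v<t t≤v

module Adversary {n b : ℕ} (A : OnlineAlgorithm n b) where

  -- Vertices are handled as natural numbers; those beyond n are never coloured.
  colourAt : Parent → ℕ → ℕ → Maybe ℕ
  colourAt f t v with v <? n
  ... | yes v<n = col A (forest n f) t (fromℕ< v<n)
  ... | no _ = nothing

  Coloured : ℕ → Parent → ℕ → ℕ → Set
  Coloured t f v c = colourAt f t v ≡ just c

  colourAt-toℕ : ∀ f t (v : Fin n) → colourAt f t (toℕ v) ≡ col A (forest n f) t v
  colourAt-toℕ f t v with toℕ v <? n
  ... | yes v<n = cong (col A (forest n f) t) (Fin.fromℕ<-toℕ v v<n)
  ... | no v≮n = ⊥-elim (v≮n (Fin.toℕ<n v))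

  coloured-vertex : ∀ {t f v c} → Coloured t f v c →
                    Σ (Fin n) λ w → toℕ w ≡ v × col A (forest n f) t w ≡ just c
  coloured-vertex {t} {f} {v} coloured with v <? n
  ... | yes v<n = fromℕ< v<n , Fin.toℕ-fromℕ< v<n , coloured

  coloured⇒arrived : ∀ {t f v c} → Coloured t f v c → v < t
  coloured⇒arrived {t} {f} coloured with coloured-vertex coloured
  ... | w , refl , colw = arrived A (forest n f) t w _ colw

  coloured-persists : ∀ {t t′ f g v c} → Extends t f g → t ≤ t′ → Coloured t f v c → Coloured t′ g v c
  coloured-persists {t} {f = f} {g} f⊑g t≤t′ coloured with coloured-vertex coloured
  ... | w , refl , colw = trans (colourAt-toℕ g _ w) (irrevocable-≤ A (forest n g) w t≤t′ (trans same-view colw))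
    where
    same-view = sym (online A (forest n f) (forest n g) t (Extends⇒agree f⊑g) w)

  coloured-proper : ∀ {t f s x c} → ChildOf f s x → Coloured t f s c → ¬ Coloured t f x c
  coloured-proper {t} {f} s↑x cs cx with coloured-vertex cs | coloured-vertex cx
  ... | s′ , refl , cols | x′ , refl , colx = proper A (forest n f) t s′ x′ _ (↑⇒edge f s↑x) cols colx

  record Rainbow (k t : ℕ) (f : Parent) (S : List ℕ) : Set where
    field
      size     : length S ≡ k
      roots    : All (Root f) S
      colours  : List ℕ
      coloured : Pointwise (Coloured t f) S colours
      distinct : Unique colours

  open Rainbow

  rainbow-persists : ∀ {k t t′ f g S} → Extends t f g → t ≤ t′ → All (Root g) S →
                     Rainbow k t f S → Rainbow k t′ g S
  rainbow-persists f⊑g t≤t′ roots′ r = record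
    { size = size r ; roots = roots′ ; colours = colours r
    ; coloured = Pointwise.map (coloured-persists f⊑g t≤t′) (coloured r) ; distinct = distinct r }

  rainbow-below : ∀ {k t f S} → Rainbow k t f S → All (_< t) S
  rainbow-below = below ∘ coloured
    where
    below : ∀ {t f S cs} → Pointwise (Coloured t f) S cs → All (_< t) S
    below [] = []
    below (cv ∷ cs) = coloured⇒arrived cv ∷ below cs

  rainbow-∷ : ∀ {k t f x c S} → Root f x → Coloured t f x c → (r : Rainbow k t f S) → c ∉ colours r →
              Rainbow (suc k) t f (x ∷ S)
  rainbow-∷ root cx r c∉ = record
    { size = cong suc (size r) ; roots = root ∷ roots r ; colours = _ ∷ colours r
    ; coloured = cx ∷ coloured r ; distinct = All.¬Any⇒All¬ (colours r) c∉ ∷ distinct r }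

  Fresh : ℕ → Parent → ℕ → List ℕ → Set
  Fresh t f x cs = ∀ {t′ g c} → t ≤ t′ → Extends t f g → Coloured t′ g x c → c ∉ cs

  Fresh-persists : ∀ {t t′ f g x cs} → Extends t f g → t ≤ t′ → Fresh t f x cs → Fresh t′ g x cs
  Fresh-persists f⊑g t≤t′ fresh t′≤t″ g⊑h = fresh (≤-trans t≤t′ t′≤t″) (Extends-trans t≤t′ f⊑g g⊑h)

  Fresh-⊆ : ∀ {t f x cs ds} → ds ⊆ cs → Fresh t f x cs → Fresh t f x ds
  Fresh-⊆ ds⊆cs fresh t≤t′ f⊑g cx = fresh t≤t′ f⊑g cx ∘ ds⊆cs

  record Item : Set where
    constructor _▵_
    field
      apex : ℕ
      base : List ℕ

  open Item

  vertices : Item → List ℕ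
  vertices i = apex i ∷ base i

  -- An item becomes a rainbow (k+1)-set as soon as its apex is coloured.
  record Candidate (k t : ℕ) (f : Parent) (i : Item) : Set where
    field
      apex-root    : Root f (apex i)
      apex-arrived : apex i < t
      base-rainbow : Rainbow k t f (base i)
      apex-fresh   : Fresh t f (apex i) (colours base-rainbow)

  open Candidate

  candidate-roots : ∀ {k t f i} → Candidate k t f i → All (Root f) (vertices i)
  candidate-roots c = apex-root c ∷ roots (base-rainbow c)

  candidate-below : ∀ {k t f i} → Candidate k t f i → All (_< t) (vertices i)
  candidate-below c = apex-arrived c ∷ rainbow-below (base-rainbow c)

  candidate-persists : ∀ {k t t′ f g i} → Extends t f g → t ≤ t′ → All (Root g) (vertices i) →
                       Candidate k t f i → Candidate k t′ g i
  candidate-persists f⊑g t≤t′ (root ∷ roots′) c = record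
    { apex-root = root ; apex-arrived = <-≤-trans (apex-arrived c) t≤t′
    ; base-rainbow = rainbow-persists f⊑g t≤t′ roots′ (base-rainbow c)
    ; apex-fresh = Fresh-persists f⊑g t≤t′ (apex-fresh c) }

  candidate-complete : ∀ {k t f i c} → Candidate k t f i → Coloured t f (apex i) c →
                       Rainbow (suc k) t f (vertices i)
  candidate-complete cand capex =
    rainbow-∷ (apex-root cand) capex (base-rainbow cand) (apex-fresh cand ≤-refl Extends-refl capex)

  -- In every continuation each s ∈ S keeps both its colour and its link to t, so t's colour avoids it.
  attached-apex-fresh : ∀ {k t f S} (r : Rainbow k t f S) → Fresh (suc t) (attach (_∈? S) t f) t (colours r)
  attached-apex-fresh {t = t} {f} {S} r {g = g} t+1≤t′ f₁⊑g ct c∈cs with pointwise-source (coloured r) c∈cs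
  ... | s , s∈S , cs = coloured-proper (s<t , gs≡t) (coloured-persists f⊑g (≤-trans (n≤1+n t) t+1≤t′) cs) ct
    where
    f₁ = attach (_∈? S) t f
    f⊑g = Extends-trans (n≤1+n t) (attach-extends (_∈? S) t f (All.lookup (roots r))) f₁⊑g
    s<t = All.lookup (rainbow-below r) s∈S
    gs≡t : g s ≡ t
    gs≡t with f₁⊑g s
    ... | inj₁ gs≡f₁s = trans gs≡f₁s (attach-hit (_∈? S) t f s∈S)
    ... | inj₂ (f₁s≡s , _) = ⊥-elim (<-irrefl (trans (sym f₁s≡s) (attach-hit (_∈? S) t f s∈S)) s<t)

  record Combined (k t : ℕ) (f : Parent) (S₁ S₂ : List ℕ) : Set where
    field
      t′        : ℕ
      f′        : Parent
      item      : Item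
      started   : t ≤ t′
      bounded   : t′ ≤ suc t
      extends   : Extends t f f′
      up′       : ForestUpTo t′ f′
      frame     : ∀ {v} → v ∉ S₁ → f′ v ≡ f v
      candidate : Candidate k t′ f′ item
      origin    : All (Origin (S₁ ++ S₂) t) (vertices item)

  combine : ∀ {k t f S₁ S₂} → ForestUpTo t f → Rainbow k t f S₁ → Rainbow k t f S₂ → Disjoint S₁ S₂ →
            Combined k t f S₁ S₂
  combine {k} {t} {f} {S₁} {S₂} up r₁ r₂ S₁#S₂ with all? (_∈? colours r₁) (colours r₂)
  ... | no ¬covered with find (All.¬All⇒Any¬ (_∈? colours r₁) (colours r₂) ¬covered)
  ...   | c , c∈cs₂ , c∉cs₁ with pointwise-source (coloured r₂) c∈cs₂
  ...     | w , w∈S₂ , cw = record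
    { t′ = t ; f′ = f ; item = w ▵ S₁ ; started = ≤-refl ; bounded = n≤1+n t
    ; extends = Extends-refl ; up′ = up ; frame = λ _ → refl
    ; candidate = record
      { apex-root = All.lookup (roots r₂) w∈S₂ ; apex-arrived = coloured⇒arrived cw ; base-rainbow = r₁
      ; apex-fresh = λ t≤t′ f⊑g cw′ →
          subst (_∉ colours r₁) (just-injective (trans (sym (coloured-persists f⊑g t≤t′ cw)) cw′)) c∉cs₁ }
    ; origin = inj₁ (∈-++⁺ʳ S₁ w∈S₂) ∷ All.tabulate (inj₁ ∘ ∈-++⁺ˡ) }
  combine {k} {t} {f} {S₁} {S₂} up r₁ r₂ S₁#S₂ | yes covered = record
    { t′ = suc t ; f′ = f₁ ; item = t ▵ S₂ ; started = n≤1+n t ; bounded = ≤-refl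
    ; extends = f⊑f₁ ; up′ = attach-forest (_∈? S₁) t f up (All.lookup (rainbow-below r₁))
    ; frame = attach-miss (_∈? S₁) t f
    ; candidate = record
      { apex-root    = trans (attach-miss (_∈? S₁) t f (<⇒∉ (rainbow-below r₁) ≤-refl)) (ForestUpTo⇒Root up ≤-refl)
      ; apex-arrived = ≤-refl
      ; base-rainbow = rainbow-persists f⊑f₁ (n≤1+n t) S₂-roots r₂
      ; apex-fresh   = Fresh-⊆ (All.lookup covered) (attached-apex-fresh r₁) }
    ; origin = inj₂ ≤-refl ∷ All.tabulate (inj₁ ∘ ∈-++⁺ʳ S₁) }
    where
    f₁ = attach (_∈? S₁) t f
    f⊑f₁ = attach-extends (_∈? S₁) t f (All.lookup (roots r₁))
    S₂-roots : All (Root f₁) S₂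
    S₂-roots = All.tabulate λ v∈S₂ →
      trans (attach-miss (_∈? S₁) t f (λ v∈S₁ → S₁#S₂ (v∈S₁ , v∈S₂))) (All.lookup (roots r₂) v∈S₂)

  record Processed (k P t : ℕ) (f : Parent) (L : List (List ℕ)) : Set where
    field
      t′         : ℕ
      f′         : Parent
      items      : List Item
      started    : t ≤ t′
      bounded    : t′ ≤ t + P
      extends    : Extends t f f′
      up′        : ForestUpTo t′ f′
      frame      : ∀ {v} → v ∉ concat L → f′ v ≡ f v
      count      : length items ≡ P
      candidates : All (Candidate k t′ f′) items
      disjoint   : AllPairs (λ i j → Disjoint (vertices i) (vertices j)) items
      origin     : All (All (Origin (concat L) t) ∘ vertices) items

  process-pairs : ∀ {k t f} P L → ForestUpTo t f → P + P ≤ length L → All (Rainbow k t f) L → AllPairs Disjoint L →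
                 Processed k P t f L
  process-pairs {t = t} {f} zero L up _ _ _ = record
    { t′ = t ; f′ = f ; items = [] ; started = ≤-refl ; bounded = m≤m+n t 0 ; extends = Extends-refl
    ; up′ = up ; frame = λ _ → refl ; count = refl ; candidates = [] ; disjoint = [] ; origin = [] }
  process-pairs (suc P) (S ∷ []) _ enough _ _ = contradiction (subst (_≤ 0) (+-suc P P) (≤-pred enough)) λ ()
  process-pairs {k} {t} (suc P) (S₁ ∷ S₂ ∷ L) up enough (r₁ ∷ r₂ ∷ rs) ((S₁#S₂ ∷ S₁#L) ∷ S₂#L ∷ L#L) = record
    { t′ = R.t′ ; f′ = R.f′ ; items = C.item ∷ R.items
    ; started = ≤-trans C.started R.started
    ; bounded = ≤-trans R.bounded (subst (C.t′ + P ≤_) (sym (+-suc t P)) (+-monoˡ-≤ P C.bounded))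
    ; extends = Extends-trans C.started C.extends R.extends
    ; up′ = R.up′
    ; frame = λ v∉ → trans (R.frame (v∉ ∘ ∈-++⁺ʳ S₁ ∘ ∈-++⁺ʳ S₂)) (C.frame (v∉ ∘ ∈-++⁺ˡ))
    ; count = cong suc R.count
    ; candidates = candidate-persists R.extends R.started item-roots C.candidate ∷ R.candidates
    ; disjoint = All.map (Origin-apart item-new) R.origin ∷ R.disjoint
    ; origin = All.map (Origin-mono (Subset.++⁺ʳ S₁ (Subset.xs⊆xs++ys S₂ (concat L))) ≤-refl) C.origin
             ∷ All.map (All.map (Origin-mono (∈-++⁺ʳ S₁ ∘ ∈-++⁺ʳ S₂) C.started)) R.origin
    }
    where
    module C = Combined (combine up r₁ r₂ S₁#S₂)
    L<t : All (_< t) (concat L)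
    L<t = All.concat⁺ (All.map rainbow-below rs)
    S₁S₂#L : Disjoint (S₁ ++ S₂) (concat L)
    S₁S₂#L = Disjoint-++ˡ (Disjoint.concat⁺ʳ S₁#L) (Disjoint.concat⁺ʳ S₂#L)
    kept : ∀ {S} → Disjoint S₁ S → Rainbow k t _ S → Rainbow k C.t′ C.f′ S
    kept S₁#S r = rainbow-persists C.extends C.started
      (All.tabulate λ v∈S → trans (C.frame (λ v∈S₁ → S₁#S (v∈S₁ , v∈S))) (All.lookup (roots r) v∈S)) r
    rest-kept : All (Rainbow k C.t′ C.f′) L
    rest-kept = All.zipWith {P = Disjoint S₁} (λ (S₁#S , r) → kept S₁#S r) (S₁#L , rs)
    module R = Processed (process-pairs P L C.up′ (pairs-pred P (length L) enough) rest-kept L#L)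
    item-outside : All (_∉ concat L) (vertices C.item)
    item-outside = All.map (λ o → Origin⇒∉ o S₁S₂#L L<t) C.origin
    item-roots : All (Root R.f′) (vertices C.item)
    item-roots = All.zipWith (λ (v∉ , root) → trans (R.frame v∉) root) (item-outside , candidate-roots C.candidate)
    item-new : All (λ v → v ∉ concat L × v < C.t′) (vertices C.item)
    item-new = All.zip (item-outside , candidate-below C.candidate)

  record Promoted (k P t : ℕ) : Set where
    field
      t′       : ℕ
      f′       : Parent
      sets     : List (List ℕ)
      bounded  : t′ ≤ t + P
      up′      : ForestUpTo t′ f′
      rainbows : All (Rainbow (suc k) t′ f′) sets
      disjoint : AllPairs Disjoint sets
      enough   : P ≤ length sets + b

  -- Of the P candidates, those whose apex is still uncoloured sit in the buffer, so at most b of them fail.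
  promote : ∀ {k t f} P L → ForestUpTo t f → P + P ≤ length L → All (Rainbow k t f) L → AllPairs Disjoint L →
            t + P ≤ n → Promoted k P t
  promote {k} {t} P L up enough rs L#L t+P≤n = record
    { t′ = R.t′ ; f′ = R.f′ ; sets = map vertices finished ; bounded = R.bounded ; up′ = R.up′
    ; rainbows = All.map⁺ (All.zipWith complete (All.filter⁺ done? R.candidates , All.all-filter done? R.items))
    ; disjoint = AllPairs.map⁺ (AllPairs.filter⁺ done? R.disjoint)
    ; enough = P≤finished+b
    }
    where
    module R = Processed (process-pairs P L up enough rs L#L)
    G = forest n R.f′
    done? : ∀ i → Dec (T (is-just (colourAt R.f′ R.t′ (apex i))))
    done? i = T? _
    finished = filter done? R.items
    pending = filter (¬? ∘ done?) R.items
    complete : ∀ {i} → Candidate k R.t′ R.f′ i × T (is-just (colourAt R.f′ R.t′ (apex i))) →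
               Rainbow (suc k) R.t′ R.f′ (vertices i)
    complete (cand , is-coloured) = candidate-complete cand (proj₂ (T-is-just is-coloured))
    U = map apex pending
    U-unique : Unique U
    U-unique = AllPairs.map⁺ (AllPairs.map (λ i#j apexes≡ → i#j (here refl , here apexes≡))
                                           (AllPairs.filter⁺ (¬? ∘ done?) R.disjoint))
    U-below : All (_< R.t′) U
    U-below = All.map⁺ (All.map (All.head ∘ candidate-below) (All.filter⁺ (¬? ∘ done?) R.candidates))
    U-uncoloured : ∀ v → toℕ v ∈ U → col A G R.t′ v ≡ nothing
    U-uncoloured v v∈U with ∈-map⁻ apex v∈U
    ... | i , i∈pending , v≡apex = trans (sym (colourAt-toℕ R.f′ R.t′ v))
      (subst (λ w → colourAt R.f′ R.t′ w ≡ nothing) (sym v≡apex)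
             (¬T-is-just (proj₂ (∈-filter⁻ (¬? ∘ done?) {xs = R.items} i∈pending))))
    U≤b : length U ≤ b
    U≤b = m∸n+o≤m⇒o≤n R.t′ b (length U)
            (≤-trans (+-monoˡ-≤ (length U) (buffer A G R.t′ (≤-trans R.bounded t+P≤n)))
                     (coloured+uncoloured≤ (col A G R.t′) (λ v → arrived A G R.t′ v _) U-unique U-below U-uncoloured))
    P≤finished+b : P ≤ length (map vertices finished) + b
    P≤finished+b = begin
      P                                          ≡⟨ sym R.count ⟩
      length R.items                             ≡⟨ length-filter-split done? R.items ⟩
      length finished + length pending          ≡⟨ sym (cong₂ _+_ (List.length-map vertices finished)
                                                                   (List.length-map apex pending)) ⟩
      length (map vertices finished) + length U  ≤⟨ +-monoʳ-≤ (length (map vertices finished)) U≤b ⟩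
      length (map vertices finished) + b         ∎
      where open ≤-Reasoning

  record Forced (k r t : ℕ) : Set where
    field
      t′      : ℕ
      f′      : Parent
      set     : List ℕ
      bounded : t′ ≤ t + cost b r
      up′     : ForestUpTo t′ f′
      rainbow : Rainbow (k + r) t′ f′ set

  force : ∀ {k t f} r L → ForestUpTo t f → cost b r ≤ length L → All (Rainbow k t f) L → AllPairs Disjoint L →
          t + cost b r ≤ n → Forced k r t
  force {k} {t} {f} zero (S ∷ _) up _ (r ∷ _) _ _ = record
    { t′ = t ; f′ = f ; set = S ; bounded = m≤m+n t 1 ; up′ = up
    ; rainbow = subst (λ j → Rainbow j t f S) (sym (+-identityʳ k)) r }
  force {k} {t} (suc r) L up enough rs L#L fits = record
    { t′ = F.t′ ; f′ = F.f′ ; set = F.set ; bounded = ≤-trans F.bounded within ; up′ = F.up′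
    ; rainbow = subst (λ j → Rainbow j F.t′ F.f′ F.set) (sym (+-suc k r)) F.rainbow }
    where
    module P = Promoted (promote (cost b r + b) L up enough rs L#L (≤-trans (+-monoʳ-≤ t (m≤m+n _ _)) fits))
    within : P.t′ + cost b r ≤ t + cost b (suc r)
    within = begin
      P.t′ + cost b r                    ≤⟨ +-monoˡ-≤ (cost b r) P.bounded ⟩
      t + (cost b r + b) + cost b r      ≡⟨ +-assoc t (cost b r + b) (cost b r) ⟩
      t + ((cost b r + b) + cost b r)    ≤⟨ +-monoʳ-≤ t (+-monoʳ-≤ (cost b r + b) (m≤m+n (cost b r) b)) ⟩
      t + cost b (suc r)                 ∎
      where open ≤-Reasoning
    module F = Forced (force r P.sets P.up′ (+-cancelʳ-≤ b (cost b r) (length P.sets) P.enough)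
                             P.rainbows P.disjoint (≤-trans within fits))

  empty-rainbow : ∀ {t f} → Rainbow 0 t f []
  empty-rainbow = record { size = refl ; roots = [] ; colours = [] ; coloured = [] ; distinct = [] }

  empties-disjoint : ∀ m → AllPairs Disjoint (replicate m ([] {A = ℕ}))
  empties-disjoint zero = []
  empties-disjoint (suc m) = All.replicate⁺ m (λ ()) ∷ empties-disjoint m

  forcing-tree : ∀ K → cost b K < n → Σ (Graph n) λ G → IsTree G × K ≤ colorsUsed A G
  forcing-tree K cost<n = forest n F , forest-isTree F rooted , K≤colours
    where
    module R = Forced (force K (replicate (cost b K) []) (λ v v≢v → ⊥-elim (v≢v refl))
                        (≤-reflexive (sym (List.length-replicate (cost b K) {x = []})))
                        (All.replicate⁺ (cost b K) empty-rainbow) (empties-disjoint (cost b K)) (<⇒≤ cost<n))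
    t′≤top : R.t′ ≤ pred n
    t′≤top = ≤-trans R.bounded (pred-mono-≤ cost<n)
    hang? : ∀ v → Dec (Root R.f′ v × v < pred n)
    hang? v = (R.f′ v ≟ v) ×-dec (v <? pred n)
    F = attach hang? (pred n) R.f′
    f′⊑F : Extends R.t′ R.f′ F
    f′⊑F = Extends-anti t′≤top (attach-extends hang? (pred n) R.f′ proj₁)
    rooted : ∀ v → suc v < n → v < F v × F v < n
    rooted v v+1<n with hang? v
    ... | yes hang@(_ , v<top) =
      subst (λ p → v < p × p < n) (sym (attach-hit hang? (pred n) R.f′ hang)) (v<top , m<n⇒pred[n]<n v+1<n)
    ... | no ¬hang = subst (λ p → v < p × p < n) (sym (attach-miss hang? (pred n) R.f′ ¬hang))
                       (proj₁ link , <-≤-trans (proj₂ link) (≤-trans t′≤top (<⇒≤ (m<n⇒pred[n]<n v+1<n))))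
      where
      link = R.up′ v (λ root → ¬hang (root , pred-mono-≤ v+1<n))
    K≤colours : K ≤ colorsUsed A (forest n F)
    K≤colours = subst (_≤ colorsUsed A (forest n F)) K-colours (unique-⊆⇒length-≤ _≟_ (distinct R.rainbow) used)
      where
      K-colours : length (colours R.rainbow) ≡ K
      K-colours = trans (sym (Pointwise.Pointwise-length (coloured R.rainbow))) (size R.rainbow)
      used : colours R.rainbow ⊆ deduplicate _≟_ (mapMaybe (col A (forest n F) n) (allFin n))
      used c∈cs with pointwise-source (coloured R.rainbow) c∈cs
      ... | s , _ , cs with coloured-vertex (coloured-persists f′⊑F (≤-trans t′≤top pred[n]≤n) cs)
      ...   | w , _ , colw = ∈-deduplicate⁺ _≟_ (∈-mapMaybe⁺ (∈-allFin w) colw)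

-- Arithmetic

^-distribʳ-* : ∀ m n k → (m * n) ^ k ≡ m ^ k * n ^ k
^-distribʳ-* m n zero = refl
^-distribʳ-* m n (suc k) =
  trans (cong ((m * n) *_) (^-distribʳ-* m n k)) ([m*n]*[o*p]≡[m*o]*[n*p] m n (m ^ k) (n ^ k))

[2b+1]^q≤4^q*x : ∀ b q {x} → b ^ q ≤ x → 0 < x → (2 * b + 1) ^ q ≤ 4 ^ q * x
[2b+1]^q≤4^q*x zero q _ 0<x = subst (_≤ 4 ^ q * _) (sym (^-zeroˡ q)) (*-mono-≤ (m^n>0 4 q) 0<x)
[2b+1]^q≤4^q*x b@(suc _) q {x} b^q≤x _ = begin
  (2 * b + 1) ^ q                ≤⟨ ^-monoˡ-≤ q 2b+1≤4b ⟩
  (4 * b) ^ q                    ≡⟨ ^-distribʳ-* 4 b q ⟩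
  4 ^ q * b ^ q                  ≤⟨ *-monoʳ-≤ (4 ^ q) b^q≤x ⟩
  4 ^ q * x                      ∎
  where
  open ≤-Reasoning
  2b+1≤4b : 2 * b + 1 ≤ 4 * b
  2b+1≤4b = subst (2 * b + 1 ≤_) (sym (*-distribʳ-+ b 2 2))
                  (+-monoʳ-≤ (2 * b) (≤-trans (s≤s z≤n) (m≤n*m b 2)))

2^7q≤n^p⇒1<n : ∀ {n p q} → 0 < q → 2 ^ (7 * q) ≤ n ^ p → 1 < n
2^7q≤n^p⇒1<n {n} {p} {q} 0<q 2^7q≤n^p = ≰⇒> λ n≤1 →
  <⇒≱ (^-monoʳ-< 2 (s≤s (s≤s z≤n)) (<-≤-trans 0<q (m≤n*m q 7)))
      (≤-trans 2^7q≤n^p (subst (n ^ p ≤_) (^-zeroˡ p) (^-monoˡ-≤ p n≤1)))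

-- n^q ≤ 2^((K+1)q) (2b+1)^q ≤ 2^((K+3)q) n^(q-p), and 2^(7q) ≤ n^p then forces K ≥ 4, so K + 3 ≤ 4K.
log-bound : ∀ {p q n b K} → 0 < p → p ≤ q → b ^ q ≤ n ^ (q ∸ p) → 2 ^ (7 * q) ≤ n ^ p →
            n ≤ 2 ^ suc K * (2 * b + 1) → n ^ p ≤ 2 ^ (4 * q * K)
log-bound {p} {q} {n} {b} {K} 0<p p≤q b^q≤n^r 2^7q≤n^p n≤ = ≤-trans n^p≤2^E (^-monoʳ-≤ 2 E≤4qK)
  where
  r = q ∸ p
  E = (suc K + 2) * q
  0<q = <-≤-trans 0<p p≤q
  0<n^r : 0 < n ^ r
  0<n^r = m^n>0 n {{>-nonZero (<-trans z<s (2^7q≤n^p⇒1<n {p = p} 0<q 2^7q≤n^p))}} r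
  n^p≤2^E : n ^ p ≤ 2 ^ E
  n^p≤2^E = *-cancelʳ-≤ (n ^ p) (2 ^ E) (n ^ r) {{>-nonZero 0<n^r}} (begin
    n ^ p * n ^ r                          ≡⟨ sym (^-distribˡ-+-* n p r) ⟩
    n ^ (p + r)                            ≡⟨ cong (n ^_) (m+[n∸m]≡n p≤q) ⟩
    n ^ q                                  ≤⟨ ^-monoˡ-≤ q n≤ ⟩
    (2 ^ suc K * (2 * b + 1)) ^ q          ≡⟨ ^-distribʳ-* (2 ^ suc K) (2 * b + 1) q ⟩
    (2 ^ suc K) ^ q * (2 * b + 1) ^ q      ≤⟨ *-monoʳ-≤ ((2 ^ suc K) ^ q) ([2b+1]^q≤4^q*x b q b^q≤n^r 0<n^r) ⟩
    (2 ^ suc K) ^ q * (4 ^ q * n ^ r)      ≡⟨ sym (*-assoc ((2 ^ suc K) ^ q) (4 ^ q) (n ^ r)) ⟩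
    (2 ^ suc K) ^ q * 4 ^ q * n ^ r        ≡⟨ cong (_* n ^ r) powers ⟩
    2 ^ E * n ^ r                          ∎)
    where
    open ≤-Reasoning
    powers : (2 ^ suc K) ^ q * 4 ^ q ≡ 2 ^ E
    powers = trans (cong₂ _*_ (^-*-assoc 2 (suc K) q) (^-*-assoc 2 2 q))
                   (trans (sym (^-distribˡ-+-* 2 (suc K * q) (2 * q))) (cong (2 ^_) (sym (*-distribʳ-+ q (suc K) 2))))
  7q≤E : 7 * q ≤ E
  7q≤E = ≮⇒≥ λ E<7q → <⇒≱ (^-monoʳ-< 2 (s≤s (s≤s z≤n)) E<7q) (≤-trans 2^7q≤n^p n^p≤2^E)
  4≤K : 4 ≤ K
  4≤K = +-cancelʳ-≤ 2 4 K (≤-pred (*-cancelʳ-≤ 7 (suc K + 2) q {{>-nonZero 0<q}} 7q≤E))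
  E≤4qK : E ≤ 4 * q * K
  E≤4qK = begin
    (suc K + 2) * q                        ≡⟨ cong (_* q) (sym (+-suc K 2)) ⟩
    (K + 3) * q                            ≤⟨ *-monoˡ-≤ q (+-monoʳ-≤ K (*-monoʳ-≤ 3 (≤-trans (s≤s z≤n) 4≤K))) ⟩
    4 * K * q                              ≡⟨ *-assoc 4 K q ⟩
    4 * (K * q)                            ≡⟨ cong (4 *_) (*-comm K q) ⟩
    4 * (q * K)                            ≡⟨ sym (*-assoc 4 q K) ⟩
    4 * q * K                              ∎
    where open ≤-Reasoning

corollary9 : Σ ℕ λ c1 → Σ ℕ λ c2 → 0 < c1 × 0 < c2 ×
    ((p q : ℕ) → 0 < p → p ≤ q → (n b : ℕ) →
      b ^ q ≤ n ^ (q ∸ p) → 2 ^ (7 * q) ≤ n ^ p →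
      (A : OnlineAlgorithm n b) →
      Σ (Graph n) λ G → IsTree G × n ^ (c1 * p) ≤ 2 ^ (c2 * q * colorsUsed A G))
corollary9 = 1 , 4 , z<s , z<s , λ p q 0<p p≤q n b b^q≤n^[q-p] 2^7q≤n^p A →
  let K , cost<n , n≤cost = crossing (cost b) n (2^7q≤n^p⇒1<n {p = p} (<-≤-trans 0<p p≤q) 2^7q≤n^p)
                                     (<⇒≤ (r<cost b n))
      G , tree , K≤colours = Adversary.forcing-tree A K cost<n
      n≤2^[K+1][2b+1] = ≤-trans n≤cost (≤-trans (m≤m+n _ (2 * b)) (cost-bound b (suc K)))
      open ≤-Reasoning
  in G , tree , (begin
    n ^ (1 * p)                    ≡⟨ cong (n ^_) (*-identityˡ p) ⟩
    n ^ p                          ≤⟨ log-bound 0<p p≤q b^q≤n^[q-p] 2^7q≤n^p n≤2^[K+1][2b+1] ⟩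
    2 ^ (4 * q * K)                ≤⟨ ^-monoʳ-≤ 2 (*-monoʳ-≤ (4 * q) K≤colours) ⟩
    2 ^ (4 * q * colorsUsed A G)   ∎)
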